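{- Let $T=(V,E)$ be a rooted tree, $\ell$ a nonnegative integer, and $M\subseteq V$ a set of more than $\ell$ nodes. Then there is a subtree $U$ of $T$ with topmost node $u$ such that the induced subgraph $T[(V\setminus V(U))\cup\{u\}]$ is connected and $\frac{\ell}{2}\le|M\cap(V(U)\setminus\{u\})|\le\ell$.
   Context: A subtree of a rooted tree is a connected subgraph; its topmost node is its node closest to the root. -}

module Defs where

open import Data.Nat using (ℕ; zero; suc; _≤_)
open import Data.Fin using (Fin)
open import Data.Fin.Subset using (Subset; _∈_)
open import Data.Product using (Σ; ∃; _×_)
open import Data.Sum using (_⊎_)
open import Function using (_∘_)
open import Relation.Binary.PropositionalEquality using (_≡_; _≢_)
open import Relation.Binary.Construct.Closure.ReflexiveTransitive using (Star)

iter : ∀ {A : Set} → (A → A) → ℕ → A → A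
iter f zero    x = x
iter f (suc k) x = f (iter f k x)

-- Edges are {v , parent v} for v ≢ root; every vertex reaches the root by
-- iterating parent, so the resulting graph is a tree rooted at 'root'.
record RootedTree (n : ℕ) : Set where
  field
    root        : Fin n
    parent      : Fin n → Fin n
    parent-root : parent root ≡ root
    reaches     : ∀ v → ∃ λ k → iter parent k v ≡ root

module _ {n : ℕ} (T : RootedTree n) where
  open RootedTree T

  Adj : Fin n → Fin n → Set
  Adj a b = (a ≢ root × parent a ≡ b) ⊎ (b ≢ root × parent b ≡ a)

  AdjIn : Subset n → Fin n → Fin n → Set
  AdjIn S a b = a ∈ S × b ∈ S × Adj a b

  Connected : Subset n → Set
  Connected S = ∀ x y → x ∈ S → y ∈ S → Star (AdjIn S) x y

  -- depth u ≤ depth x  (distance to the root, via the parent map)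
  DepthLE : Fin n → Fin n → Set
  DepthLE u x = ∀ k → iter parent k x ≡ root → ∃ λ j → j ≤ k × iter parent j u ≡ root

  Topmost : Subset n → Fin n → Set
  Topmost U u = u ∈ U × (∀ x → x ∈ U → DepthLE u x)

-- Let t = ⌈ℓ/2⌉. Call a node heavy if at least t marked nodes lie strictly below it. The root
-- is heavy since |M| > ℓ, so there is a heavy node v all of whose children are light; each
-- child subtree then contains at most t marked nodes. Adding the child subtrees of v one at a
-- time, the number of marked nodes strictly below v grows from 0 to at least t in steps of at
-- most t, so at some stage it lies in [t , 2t - 1] ⊆ [ℓ/2 , ℓ]. The union of v with the child
-- subtrees added so far is the required U, with topmost node v; removing it except for v
-- leaves a set closed under taking parents, hence connected.
module Submission where

open import Defs
open import Data.Nat using (ℕ; zero; suc; _+_; _∸_; _*_; _≤_; _<_; z≤n; s≤s; _≤?_; _<?_; ⌈_/2⌉; ⌊_/2⌋)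
open import Data.Nat.Properties renaming (_≟_ to _≟ℕ_)
open import Data.Nat.Induction using (<-wellFounded)
open import Data.Fin using (Fin; toℕ; _≟_)
open import Data.Fin.Properties using (any?; toℕ-injective; toℕ<n)
open import Data.Fin.Subset using (Subset; _∈_; _∉_; _⊆_; _⊂_; ⊥; ∣_∣; _∩_; _∪_; _─_; _-_; ∁; ⁅_⁆; inside; outside)
open import Data.Fin.Subset.Properties
  using (x∈p∩q⁺; x∈p∩q⁻; x∈p∪q⁺; x∈p∪q⁻; x∈p∧x≢y⇒x∈p-y; p─q⊆p; x∈⁅x⁆; x∈⁅y⁆⇒x≡y; ∣⁅x⁆∣≡1; ∣⊥∣≡0;
         p⊆q⇒∣p∣≤∣q∣; p⊂q⇒∣p∣<∣q∣; x∉p⇒x∈∁p; x∈∁p⇒x∉p)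
open import Data.Product using (Σ; ∃; _×_; _,_; proj₁; proj₂)
open import Data.Sum using (_⊎_; inj₁; inj₂)
open import Data.Empty using (⊥-elim)
open import Data.Vec using ([]; _∷_; tabulate; here; there)
open import Data.Vec.Properties using (lookup∘tabulate; lookup⇒[]=; []=⇒lookup)
open import Induction.WellFounded using (Acc; acc)
open import Relation.Nullary using (¬_; Dec; yes; no; does)
open import Relation.Nullary.Decidable using (_×-dec_; _⊎-dec_; ¬?; dec-true)
open import Relation.Binary.PropositionalEquality using (_≡_; _≢_; refl; sym; trans; cong; subst; module ≡-Reasoning)
open import Relation.Binary.Construct.Closure.ReflexiveTransitive using (Star; ε; _◅_; _◅◅_; reverse)

module _ {A : Set} (f : A → A) where

  iter-suc : ∀ k x → iter f (suc k) x ≡ iter f k (f x)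
  iter-suc zero    x = refl
  iter-suc (suc k) x = cong f (iter-suc k x)

  iter-+ : ∀ a b x → iter f (a + b) x ≡ iter f a (iter f b x)
  iter-+ zero    b x = refl
  iter-+ (suc a) b x = cong f (iter-+ a b x)

  iter-fixedPoint : ∀ {r} → f r ≡ r → ∀ k → iter f k r ≡ r
  iter-fixedPoint fr≡r zero    = refl
  iter-fixedPoint fr≡r (suc k) = trans (cong f (iter-fixedPoint fr≡r k)) fr≡r

  iter-periodic : ∀ {j y} → iter f (suc j) y ≡ y → ∀ m → iter f (m * suc j) y ≡ y
  iter-periodic         period zero    = refl
  iter-periodic {j} {y} period (suc m) =
    trans (iter-+ (suc j) (m * suc j) y) (trans (cong (iter f (suc j)) (iter-periodic period m)) period)

⌈n/2⌉≤m⇒n≤2*m : ∀ {n m} → ⌈ n /2⌉ ≤ m → n ≤ 2 * m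
⌈n/2⌉≤m⇒n≤2*m {n} {m} ⌈n/2⌉≤m = begin
  n                  ≡⟨ ⌊n/2⌋+⌈n/2⌉≡n n ⟨
  ⌊ n /2⌋ + ⌈ n /2⌉  ≤⟨ +-monoˡ-≤ ⌈ n /2⌉ (⌊n/2⌋≤⌈n/2⌉ n) ⟩
  ⌈ n /2⌉ + ⌈ n /2⌉  ≤⟨ +-mono-≤ ⌈n/2⌉≤m ⌈n/2⌉≤m ⟩
  m + m              ≡⟨ cong (m +_) (+-identityʳ m) ⟨
  2 * m              ∎
  where open ≤-Reasoning

⌈n/2⌉+⌈n/2⌉≤1+n : ∀ n → ⌈ n /2⌉ + ⌈ n /2⌉ ≤ suc n
⌈n/2⌉+⌈n/2⌉≤1+n n = begin
  ⌈ n /2⌉ + ⌈ n /2⌉          ≤⟨ +-monoʳ-≤ ⌈ n /2⌉ (⌈n/2⌉-mono (n≤1+n n)) ⟩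
  ⌊ suc n /2⌋ + ⌈ suc n /2⌉  ≡⟨ ⌊n/2⌋+⌈n/2⌉≡n (suc n) ⟩
  suc n                      ∎
  where open ≤-Reasoning

-- A discrete intermediate value theorem: increments of at most d cannot jump over [a , b].
window-hit : (f : ℕ → ℕ) {a b d : ℕ} → f 0 ≤ b → (∀ k → f (suc k) ≤ f k + d) → a + d ≤ suc b →
             ∀ N → a ≤ f N → ∃ λ k → a ≤ f k × f k ≤ b
window-hit f f0≤b step a+d≤1+b zero    a≤f0  = 0 , a≤f0 , f0≤b
window-hit f {a} {b} {d} f0≤b step a+d≤1+b (suc N) a≤f[1+N] with a ≤? f N
... | yes a≤fN = window-hit f f0≤b step a+d≤1+b N a≤fN
... | no  a≰fN = suc N , a≤f[1+N] , ≤-pred (begin-strict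
  f (suc N)  ≤⟨ step N ⟩
  f N + d    <⟨ +-monoˡ-< d (≰⇒> a≰fN) ⟩
  a + d      ≤⟨ a+d≤1+b ⟩
  suc b      ∎)
  where open ≤-Reasoning

module _ {n : ℕ} {P : Fin n → Set} (P? : ∀ x → Dec (P x)) where

  fromDec : Subset n
  fromDec = tabulate (λ x → does (P? x))

  ∈-fromDec⁺ : ∀ {x} → P x → x ∈ fromDec
  ∈-fromDec⁺ {x} px = lookup⇒[]= x fromDec (trans (lookup∘tabulate _ x) (dec-true (P? x) px))

  ∈-fromDec⁻ : ∀ {x} → x ∈ fromDec → P x
  ∈-fromDec⁻ {x} x∈ with P? x | trans (sym (lookup∘tabulate (λ y → does (P? y)) x)) ([]=⇒lookup x∈)
  ... | yes px | _ = px
  ... | no  _  | ()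

x∈p─q⇒x∉q : ∀ {n} (p q : Subset n) {x} → x ∈ p ─ q → x ∉ q
x∈p─q⇒x∉q (inside ∷ p) (outside ∷ q) here      ()
x∈p─q⇒x∉q (_      ∷ p) (_       ∷ q) (there x∈) (there x∈q) = x∈p─q⇒x∉q p q x∈ x∈q

∣p∪q∣≤∣p∣+∣q∣ : ∀ {n} (p q : Subset n) → ∣ p ∪ q ∣ ≤ ∣ p ∣ + ∣ q ∣
∣p∪q∣≤∣p∣+∣q∣ []            []            = z≤n
∣p∪q∣≤∣p∣+∣q∣ (inside  ∷ p) (inside  ∷ q) =
  s≤s (≤-trans (∣p∪q∣≤∣p∣+∣q∣ p q) (≤-trans (n≤1+n _) (≤-reflexive (sym (+-suc ∣ p ∣ ∣ q ∣)))))
∣p∪q∣≤∣p∣+∣q∣ (inside  ∷ p) (outside ∷ q) = s≤s (∣p∪q∣≤∣p∣+∣q∣ p q)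
∣p∪q∣≤∣p∣+∣q∣ (outside ∷ p) (inside  ∷ q) =
  ≤-trans (s≤s (∣p∪q∣≤∣p∣+∣q∣ p q)) (≤-reflexive (sym (+-suc ∣ p ∣ ∣ q ∣)))
∣p∪q∣≤∣p∣+∣q∣ (outside ∷ p) (outside ∷ q) = ∣p∪q∣≤∣p∣+∣q∣ p q

module _ {n : ℕ} {p q : Subset n} {y x : Fin n} where

  x∈p∩[q-y]⁺ : x ∈ p → x ∈ q → x ≢ y → x ∈ p ∩ (q - y)
  x∈p∩[q-y]⁺ x∈p x∈q x≢y = x∈p∩q⁺ (x∈p , x∈p∧x≢y⇒x∈p-y x∈q x≢y)

  x∈p∩[q-y]⁻ : x ∈ p ∩ (q - y) → x ∈ p × x ∈ q × x ≢ y
  x∈p∩[q-y]⁻ x∈ with x∈p∩q⁻ p (q - y) x∈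
  ... | x∈p , x∈q-y =
    x∈p , p─q⊆p q ⁅ y ⁆ x∈q-y , λ { refl → x∈p─q⇒x∉q q ⁅ y ⁆ x∈q-y (x∈⁅x⁆ y) }

∣p∩q∣≤1+∣p∩[q-y]∣ : ∀ {n} (p q : Subset n) y → ∣ p ∩ q ∣ ≤ suc ∣ p ∩ (q - y) ∣
∣p∩q∣≤1+∣p∩[q-y]∣ p q y = begin
  ∣ p ∩ q ∣                        ≤⟨ p⊆q⇒∣p∣≤∣q∣ split ⟩
  ∣ p ∩ (q - y) ∪ ⁅ y ⁆ ∣          ≤⟨ ∣p∪q∣≤∣p∣+∣q∣ (p ∩ (q - y)) ⁅ y ⁆ ⟩
  ∣ p ∩ (q - y) ∣ + ∣ ⁅ y ⁆ ∣      ≡⟨ cong (∣ p ∩ (q - y) ∣ +_) (∣⁅x⁆∣≡1 y) ⟩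
  ∣ p ∩ (q - y) ∣ + 1              ≡⟨ +-comm _ 1 ⟩
  suc ∣ p ∩ (q - y) ∣              ∎
  where
  open ≤-Reasoning
  split : p ∩ q ⊆ p ∩ (q - y) ∪ ⁅ y ⁆
  split {x} x∈ with x ≟ y | x∈p∩q⁻ p q x∈
  ... | yes refl | _           = x∈p∪q⁺ (inj₂ (x∈⁅x⁆ x))
  ... | no  x≢y  | x∈p , x∈q   = x∈p∪q⁺ (inj₁ (x∈p∩[q-y]⁺ x∈p x∈q x≢y))

module _ {n : ℕ} (T : RootedTree n) where
  open RootedTree T

  parent^ : ℕ → Fin n → Fin n
  parent^ = iter parent

  parent^-root : ∀ {k j x} → parent^ k x ≡ root → k ≤ j → parent^ j x ≡ root
  parent^-root {k} {j} {x} at-root k≤j = begin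
    parent^ j x                          ≡⟨ cong (λ i → parent^ i x) (m∸n+n≡m k≤j) ⟨
    parent^ (j ∸ k + k) x                ≡⟨ iter-+ parent (j ∸ k) k x ⟩
    parent^ (j ∸ k) (parent^ k x)        ≡⟨ cong (parent^ (j ∸ k)) at-root ⟩
    parent^ (j ∸ k) root                 ≡⟨ iter-fixedPoint parent parent-root (j ∸ k) ⟩
    root                                 ∎
    where open ≡-Reasoning

  periodic⇒root : ∀ {j y} → parent^ (suc j) y ≡ y → y ≡ root
  periodic⇒root {j} {y} period with reaches y
  ... | K , at-root =
    trans (sym (iter-periodic parent period K))
          (parent^-root at-root (≤-trans (m≤m+n K (K * j)) (≤-reflexive (sym (*-suc K j)))))

  -- x ≼ c : c lies on the path from x to the root, i.e. x is in the subtree of c.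
  _≼_ : Fin n → Fin n → Set
  x ≼ c = ∃ λ j → parent^ j x ≡ c

  _≼?_ : ∀ x c → Dec (x ≼ c)
  x ≼? c with reaches x | anyUpTo? (λ j → parent^ j x ≟ c) (suc (proj₁ (reaches x)))
  ... | _ | yes (j , _ , x↑j≡c) = yes (j , x↑j≡c)
  ... | K , at-root | no none = no λ (j , x↑j≡c) → none (bounded j x↑j≡c)
    where
    bounded : ∀ j → parent^ j x ≡ c → ∃ λ i → i < suc K × parent^ i x ≡ c
    bounded j x↑j≡c with j ≤? K
    ... | yes j≤K = j , s≤s j≤K , x↑j≡c
    ... | no  j≰K = K , ≤-refl , trans at-root (trans (sym (parent^-root at-root (<⇒≤ (≰⇒> j≰K)))) x↑j≡c)

  ≼⇒depth≤ : ∀ {x u} → x ≼ u → DepthLE T u x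
  ≼⇒depth≤ {x} {u} (i , x↑i≡u) m x↑m≡root with i ≤? m
  ... | yes i≤m = m ∸ i , m∸n≤m m i , (begin
    parent^ (m ∸ i) u              ≡⟨ cong (parent^ (m ∸ i)) x↑i≡u ⟨
    parent^ (m ∸ i) (parent^ i x)  ≡⟨ iter-+ parent (m ∸ i) i x ⟨
    parent^ (m ∸ i + i) x          ≡⟨ cong (λ k → parent^ k x) (m∸n+n≡m i≤m) ⟩
    parent^ m x                    ≡⟨ x↑m≡root ⟩
    root                           ∎)
    where open ≡-Reasoning
  ... | no  i≰m = 0 , z≤n , trans (sym x↑i≡u) (parent^-root x↑m≡root (<⇒≤ (≰⇒> i≰m)))

  Child : Fin n → Fin n → Set
  Child v c = parent c ≡ v × c ≢ v

  child? : ∀ v c → Dec (Child v c)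
  child? v c = (parent c ≟ v) ×-dec ¬? (c ≟ v)

  child≢root : ∀ {v c} → Child v c → c ≢ root
  child≢root (pc≡v , c≢v) refl = c≢v (trans (sym parent-root) pc≡v)

  ≼-nonRoot : ∀ {x c} → x ≼ c → c ≢ root → x ≢ root
  ≼-nonRoot (j , x↑j≡c) c≢root refl = c≢root (trans (sym x↑j≡c) (iter-fixedPoint parent parent-root j))

  parent≼⇒≼ : ∀ {x c} → parent x ≼ c → x ≼ c
  parent≼⇒≼ {x} (j , px↑j≡c) = suc j , trans (iter-suc parent j x) px↑j≡c

  ≼⇒parent≼ : ∀ {x c} → x ≼ c → x ≢ c → parent x ≼ c
  ≼⇒parent≼     (zero  , x≡c)  x≢c = ⊥-elim (x≢c x≡c)
  ≼⇒parent≼ {x} (suc j , x↑≡c) _   = j , trans (sym (iter-suc parent j x)) x↑≡c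

  parent⋠child : ∀ {v c} → Child v c → ¬ (v ≼ c)
  parent⋠child {v} {c} (pc≡v , c≢v) (j , v↑j≡c) = c≢v (begin
    c               ≡⟨ v↑j≡c ⟨
    parent^ j v     ≡⟨ cong (parent^ j) v≡root ⟩
    parent^ j root  ≡⟨ iter-fixedPoint parent parent-root j ⟩
    root            ≡⟨ v≡root ⟨
    v               ∎)
    where
    open ≡-Reasoning
    v≡root : v ≡ root
    v≡root = periodic⇒root {j} (trans (cong parent v↑j≡c) pc≡v)

  ≼-child : ∀ {x v} → x ≼ v → x ≢ v → ∃ λ c → Child v c × x ≼ c
  ≼-child {x} {v} (j , x↑j≡v) = go j x x↑j≡v
    where
    go : ∀ j y → parent^ j y ≡ v → y ≢ v → ∃ λ c → Child v c × y ≼ c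
    go zero    y y≡v y≢v = ⊥-elim (y≢v y≡v)
    go (suc j) y y↑≡v y≢v with parent y ≟ v
    ... | yes py≡v = y , (py≡v , y≢v) , (0 , refl)
    ... | no  py≢v with go j (parent y) (trans (sym (iter-suc parent j y)) y↑≡v) py≢v
    ...   | c , c-child , (i , py↑i≡c) = c , c-child , (suc i , trans (iter-suc parent i y) py↑i≡c)

  subtree : Fin n → Subset n
  subtree c = fromDec (_≼? c)

  subtree-child⊂ : ∀ {v c} → Child v c → subtree c ⊂ subtree v
  subtree-child⊂ {v} {c} (pc≡v , c≢v) =
    below-c⇒below-v , v , ∈-fromDec⁺ (_≼? v) (0 , refl) ,
    λ v∈ → parent⋠child (pc≡v , c≢v) (∈-fromDec⁻ (_≼? c) v∈)
    where
    below-c⇒below-v : subtree c ⊆ subtree v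
    below-c⇒below-v x∈ with ∈-fromDec⁻ (_≼? c) x∈
    ... | j , x↑j≡c = ∈-fromDec⁺ (_≼? v) (suc j , trans (cong parent x↑j≡c) pc≡v)

  lowest : {P : Fin n → Set} → (∀ x → Dec (P x)) → ∀ {v} → P v → ∃ λ w → P w × (∀ c → Child w c → ¬ P c)
  lowest {P} P? {v} pv = go v (<-wellFounded ∣ subtree v ∣) pv
    where
    go : ∀ v → Acc _<_ ∣ subtree v ∣ → P v → ∃ λ w → P w × (∀ c → Child w c → ¬ P c)
    go v (acc smaller) pv with any? (λ c → child? v c ×-dec P? c)
    ... | yes (c , c-child , pc) = go c (smaller (p⊂q⇒∣p∣<∣q∣ (subtree-child⊂ c-child))) pc
    ... | no  none               = v , pv , λ c c-child pc → none (c , c-child , pc)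

  -- Following parents leads from any node of S to c without leaving S.
  ParentClosed : Subset n → Fin n → Set
  ParentClosed S c = ∀ x → x ∈ S → x ≢ c → x ≢ root × parent x ∈ S

  parentClosed⇒connected : ∀ {S c} → ParentClosed S c → Connected T S
  parentClosed⇒connected {S} {c} closed x y x∈ y∈ =
    toCentre x x∈ ◅◅ reverse flip (toCentre y y∈)
    where
    flip : ∀ {a b} → AdjIn T S a b → AdjIn T S b a
    flip (a∈ , b∈ , inj₁ edge) = b∈ , a∈ , inj₂ edge
    flip (a∈ , b∈ , inj₂ edge) = b∈ , a∈ , inj₁ edge

    climb : ∀ k x → parent^ k x ≡ root → x ∈ S → Star (AdjIn T S) x c
    climb k x at-root x∈ with x ≟ c
    climb k       x at-root x∈ | yes refl = ε
    climb zero    x at-root x∈ | no  x≢c  = ⊥-elim (proj₁ (closed x x∈ x≢c) at-root)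
    climb (suc k) x at-root x∈ | no  x≢c with closed x x∈ x≢c
    ... | x≢root , px∈ =
      (x∈ , px∈ , inj₁ (x≢root , refl)) ◅ climb k (parent x) (trans (sym (iter-suc parent k x)) at-root) px∈

    toCentre : ∀ x → x ∈ S → Star (AdjIn T S) x c
    toCentre x = climb (proj₁ (reaches x)) x (proj₂ (reaches x))

  InFan : Fin n → ℕ → Fin n → Set
  InFan v k x = x ≡ v ⊎ ∃ λ c → toℕ c < k × Child v c × x ≼ c

  inFan? : ∀ v k x → Dec (InFan v k x)
  inFan? v k x = (x ≟ v) ⊎-dec any? (λ c → (toℕ c <? k) ×-dec (child? v c ×-dec (x ≼? c)))

  fan : Fin n → ℕ → Subset n
  fan v k = fromDec (inFan? v k)

  inFan⇒≼ : ∀ {v k x} → InFan v k x → x ≼ v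
  inFan⇒≼ (inj₁ refl)                               = 0 , refl
  inFan⇒≼ (inj₂ (c , _ , (pc≡v , _) , (i , x↑i≡c))) = suc i , trans (cong parent x↑i≡c) pc≡v

  inFan-suc : ∀ {v k x} → InFan v (suc k) x → InFan v k x ⊎ ∃ λ c → toℕ c ≡ k × Child v c × x ≼ c
  inFan-suc (inj₁ x≡v) = inj₁ (inj₁ x≡v)
  inFan-suc (inj₂ (c , s≤s c≤k , c-child , x≼c)) with m≤n⇒m<n∨m≡n c≤k
  ... | inj₁ c<k = inj₁ (inj₂ (c , c<k , c-child , x≼c))
  ... | inj₂ c≡k = inj₂ (c , c≡k , c-child , x≼c)

  fan-topmost : ∀ v k → Topmost T (fan v k) v
  fan-topmost v k =
    ∈-fromDec⁺ (inFan? v k) (inj₁ refl) , λ x x∈ → ≼⇒depth≤ (inFan⇒≼ (∈-fromDec⁻ (inFan? v k) x∈))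

  fan-parentClosed : ∀ v k → ParentClosed (fan v k) v
  fan-parentClosed v k x x∈ x≢v with ∈-fromDec⁻ (inFan? v k) x∈
  ... | inj₁ x≡v = ⊥-elim (x≢v x≡v)
  ... | inj₂ (c , c<k , c-child , x≼c) =
    ≼-nonRoot x≼c (child≢root c-child) , ∈-fromDec⁺ (inFan? v k) parent-inFan
    where
    parent-inFan : InFan v k (parent x)
    parent-inFan with x ≟ c
    ... | yes refl = inj₁ (proj₁ c-child)
    ... | no  x≢c  = inj₂ (c , c<k , c-child , ≼⇒parent≼ x≼c x≢c)

  fanᶜ-parentClosed : ∀ v k → ParentClosed (∁ (fan v k) ∪ ⁅ v ⁆) root
  fanᶜ-parentClosed v k x x∈ x≢root = x≢root , parent∈
    where
    parent∈ : parent x ∈ ∁ (fan v k) ∪ ⁅ v ⁆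
    parent∈ with parent x ≟ v | inFan? v k (parent x)
    ... | yes px≡v | _      = x∈p∪q⁺ (inj₂ (subst (_∈ ⁅ v ⁆) (sym px≡v) (x∈⁅x⁆ v)))
    ... | no  _    | no px∉ = x∈p∪q⁺ (inj₁ (x∉p⇒x∈∁p (λ px∈ → px∉ (∈-fromDec⁻ (inFan? v k) px∈))))
    ... | no  px≢v | yes (inj₁ px≡v) = ⊥-elim (px≢v px≡v)
    ... | no  _    | yes (inj₂ (c , c<k , c-child , px≼c)) with x∈p∪q⁻ (∁ (fan v k)) ⁅ v ⁆ x∈
    ...   | inj₁ x∈∁ = ⊥-elim (x∈∁p⇒x∉p x∈∁ (∈-fromDec⁺ (inFan? v k) (inj₂ (c , c<k , c-child , parent≼⇒≼ px≼c))))
    ...   | inj₂ x∈⁅v⁆ = ⊥-elim (parent⋠child c-child (subst (_≼ c) (x∈⁅y⁆⇒x≡y v x∈⁅v⁆) (parent≼⇒≼ px≼c)))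

  module _ (M : Subset n) where

    weight : Fin n → ℕ
    weight v = ∣ M ∩ (subtree v - v) ∣

    fanWeight : Fin n → ℕ → ℕ
    fanWeight v k = ∣ M ∩ (fan v k - v) ∣

    ∣M∣≤1+weight[root] : ∣ M ∣ ≤ suc (weight root)
    ∣M∣≤1+weight[root] =
      ≤-trans (p⊆q⇒∣p∣≤∣q∣ {p = M} (λ x∈M → x∈p∩q⁺ (x∈M , ∈-fromDec⁺ (_≼? root) (reaches _))))
              (∣p∩q∣≤1+∣p∩[q-y]∣ M (subtree root) root)

    fanWeight-zero : ∀ v → fanWeight v 0 ≡ 0
    fanWeight-zero v = n≤0⇒n≡0 (≤-trans (p⊆q⇒∣p∣≤∣q∣ empty) (≤-reflexive (∣⊥∣≡0 n)))
      where
      empty : M ∩ (fan v 0 - v) ⊆ ⊥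
      empty x∈ with x∈p∩[q-y]⁻ x∈
      ... | _ , x∈fan , x≢v with ∈-fromDec⁻ (inFan? v 0) x∈fan
      ...   | inj₁ x≡v = ⊥-elim (x≢v x≡v)

    weight≤fanWeight[n] : ∀ v → weight v ≤ fanWeight v n
    weight≤fanWeight[n] v = p⊆q⇒∣p∣≤∣q∣ below⊆fan
      where
      below⊆fan : M ∩ (subtree v - v) ⊆ M ∩ (fan v n - v)
      below⊆fan x∈ with x∈p∩[q-y]⁻ x∈
      ... | x∈M , x∈subtree , x≢v with ≼-child (∈-fromDec⁻ (_≼? v) x∈subtree) x≢v
      ...   | c , c-child , x≼c = x∈p∩[q-y]⁺ x∈M (∈-fromDec⁺ (inFan? v n) (inj₂ (c , toℕ<n c , c-child , x≼c))) x≢v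

    -- Each step adds at most one child subtree, holding at most 1 + weight c ≤ t marked nodes.
    fanWeight-suc : ∀ {v t} → (∀ c → Child v c → weight c < t) → ∀ k → fanWeight v (suc k) ≤ fanWeight v k + t
    fanWeight-suc {v} {t} light k with any? (λ c → (toℕ c ≟ℕ k) ×-dec child? v c)
    ... | yes (c , c≡k , c-child) = begin
      fanWeight v (suc k)                         ≤⟨ p⊆q⇒∣p∣≤∣q∣ grow ⟩
      ∣ M ∩ (fan v k - v) ∪ M ∩ subtree c ∣       ≤⟨ ∣p∪q∣≤∣p∣+∣q∣ (M ∩ (fan v k - v)) (M ∩ subtree c) ⟩
      fanWeight v k + ∣ M ∩ subtree c ∣           ≤⟨ +-monoʳ-≤ (fanWeight v k) (∣p∩q∣≤1+∣p∩[q-y]∣ M (subtree c) c) ⟩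
      fanWeight v k + suc (weight c)              ≤⟨ +-monoʳ-≤ (fanWeight v k) (light c c-child) ⟩
      fanWeight v k + t                           ∎
      where
      open ≤-Reasoning
      grow : M ∩ (fan v (suc k) - v) ⊆ M ∩ (fan v k - v) ∪ M ∩ subtree c
      grow x∈ with x∈p∩[q-y]⁻ x∈
      ... | x∈M , x∈fan , x≢v with inFan-suc (∈-fromDec⁻ (inFan? v (suc k)) x∈fan)
      ...   | inj₁ old = x∈p∪q⁺ (inj₁ (x∈p∩[q-y]⁺ x∈M (∈-fromDec⁺ (inFan? v k) old) x≢v))
      ...   | inj₂ (c′ , c′≡k , _ , x≼c′) with toℕ-injective (trans c′≡k (sym c≡k))
      ...     | refl = x∈p∪q⁺ (inj₂ (x∈p∩q⁺ (x∈M , ∈-fromDec⁺ (_≼? c) x≼c′)))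
    ... | no none = ≤-trans (p⊆q⇒∣p∣≤∣q∣ same) (m≤m+n (fanWeight v k) t)
      where
      same : M ∩ (fan v (suc k) - v) ⊆ M ∩ (fan v k - v)
      same x∈ with x∈p∩[q-y]⁻ x∈
      ... | x∈M , x∈fan , x≢v with inFan-suc (∈-fromDec⁻ (inFan? v (suc k)) x∈fan)
      ...   | inj₁ old = x∈p∩[q-y]⁺ x∈M (∈-fromDec⁺ (inFan? v k) old) x≢v
      ...   | inj₂ (c′ , c′≡k , c′-child , _) = ⊥-elim (none (c′ , c′≡k , c′-child))

lemmaA1 : ∀ {n} (T : RootedTree n) (ℓ : ℕ) (M : Subset n) → ℓ < ∣ M ∣ →
    Σ (Subset n) λ U → Σ (Fin n) λ u →
      Connected T U × Topmost T U u × Connected T (∁ U ∪ ⁅ u ⁆) ×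
      ℓ ≤ 2 * ∣ M ∩ (U - u) ∣ × ∣ M ∩ (U - u) ∣ ≤ ℓ
lemmaA1 {n} T ℓ M ℓ<∣M∣
  with lowest T (λ x → ⌈ ℓ /2⌉ ≤? weight T M x)
         (≤-trans (⌈n/2⌉≤n ℓ) (≤-pred (≤-trans ℓ<∣M∣ (∣M∣≤1+weight[root] T M))))
... | v , heavy , children-light
  with window-hit (fanWeight T M v) (≤-trans (≤-reflexive (fanWeight-zero T M v)) z≤n)
         (fanWeight-suc T M (λ c c-child → ≰⇒> (children-light c c-child))) (⌈n/2⌉+⌈n/2⌉≤1+n ℓ)
         n (≤-trans heavy (weight≤fanWeight[n] T M v))
... | k , ⌈ℓ/2⌉≤w , w≤ℓ =
  fan T v k , v ,
  parentClosed⇒connected T (fan-parentClosed T v k) , fan-topmost T v k ,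
  parentClosed⇒connected T (fanᶜ-parentClosed T v k) ,
  ⌈n/2⌉≤m⇒n≤2*m ⌈ℓ/2⌉≤w , w≤ℓ
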